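{- Let $\mathcal{M}$ be either the minority process or the majority process. A tree $T$ with $n$ nodes and maximal degree $\Delta$ has at most $\min\left(2^{n-\Delta}, 2F_{\lfloor n/2\rfloor}\right)$ pure 2-cycles of $\mathcal{M}$.
   Context: Let $T=(V,E)$ be a finite undirected tree. A coloring is a map $c:V\to\{0,1\}$. For a node $v$ and $i\in\{0,1\}$ let $N^i(v)$ be the set of neighbors $u$ of $v$ with $c(u)=i$. The minority process maps $c$ to $\mathcal{MIN}(c)$, where $\mathcal{MIN}(c)(v)=c(v)$ if $|N^{c(v)}(v)|\le |N^{1-c(v)}(v)|$ and $\mathcal{MIN}(c)(v)=1-c(v)$ otherwise, simultaneously for all $v$. The majority process $\mathcal{MAJ}$ is defined with the comparisons reversed: $\mathcal{MAJ}(c)(v)=c(v)$ if $|N^{c(v)}(v)|\ge |N^{1-c(v)}(v)|$ and $1-c(v)$ otherwise. A coloring $c$ is a pure 2-cycle of $\mathcal{M}$ if $\mathcal{M}(c)(v)\neq c(v)$ for every node $v$ and $\mathcal{M}(\mathcal{M}(c))=c$. $F_i$ denotes the $i$-th Fibonacci number: $F_0=0$, $F_1=1$, $F_i=F_{i-1}+F_{i-2}$. -}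

module Defs where

open import Data.Bool using (Bool; true; false; not; _∧_; if_then_else_)
open import Data.Nat using (ℕ; zero; suc; _+_; _*_; _≤_; _≤ᵇ_; _⊔_)
open import Data.Fin using (Fin)
open import Data.List using (List; []; _∷_; _++_; length; filter; map; foldr)
open import Data.List.Relation.Unary.Unique.Propositional using (Unique)
open import Data.Fin.Properties using (all?)
open import Relation.Nullary using (Dec; ¬?)
open import Relation.Nullary.Decidable using (_×-dec_)
open import Data.Bool.Properties renaming (_≟_ to _≟ᵇ_)
open import Data.Product using (Σ; ∃; _×_; _,_)
open import Data.Unit using (⊤)
open import Relation.Binary.PropositionalEquality using (_≡_)
open import Relation.Nullary using (¬_; does)

open import Data.List using (allFin) public
open import Data.Fin as Fin using ()

record Graph (n : ℕ) : Set where
  field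
    adj     : Fin n → Fin n → Bool
    symm    : ∀ u v → adj u v ≡ adj v u
    irrefl  : ∀ v → adj v v ≡ false

open Graph public

data Walk {n : ℕ} (G : Graph n) : Fin n → Fin n → Set where
  here : ∀ {u} → Walk G u u
  step : ∀ {u w v} → adj G u w ≡ true → Walk G w v → Walk G u v

Connected : ∀ {n} → Graph n → Set
Connected G = ∀ u v → Walk G u v

Chain : ∀ {n} → Graph n → List (Fin n) → Set
Chain G []           = ⊤
Chain G (x ∷ [])     = ⊤
Chain G (x ∷ y ∷ xs) = (adj G x y ≡ true) × Chain G (y ∷ xs)

-- a cycle: distinct vertices x, x₁, …, x_k (k ≥ 2, i.e. at least 3 vertices),
-- consecutive ones adjacent and x_k adjacent to x
HasCycle : ∀ {n} → Graph n → Set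
HasCycle {n} G = Σ (Fin n) λ x → Σ (List (Fin n)) λ xs →
  Unique (x ∷ xs) × (2 ≤ length xs) × Chain G (x ∷ xs ++ x ∷ [])

Acyclic : ∀ {n} → Graph n → Set
Acyclic G = ¬ HasCycle G

IsTree : ∀ {n} → Graph n → Set
IsTree {n} G = (1 ≤ n) × Connected G × Acyclic G

neighbours : ∀ {n} → Graph n → Fin n → List (Fin n)
neighbours {n} G v = filter (λ u → adj G v u ≟ᵇ true) (allFin n)

degree : ∀ {n} → Graph n → Fin n → ℕ
degree G v = length (neighbours G v)

maxDegree : ∀ {n} → Graph n → ℕ
maxDegree {n} G = foldr _⊔_ 0 (map (degree G) (allFin n))

Coloring : ℕ → Set
Coloring n = Fin n → Bool

N# : ∀ {n} → Graph n → Coloring n → Fin n → Bool → ℕ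
N# G c v i = length (filter (λ u → c u ≟ᵇ i) (neighbours G v))

data Process : Set where
  minority majority : Process

run : ∀ {n} → Process → Graph n → Coloring n → Coloring n
run minority G c v =
  if N# G c v (c v) ≤ᵇ N# G c v (not (c v)) then c v else not (c v)
run majority G c v =
  if N# G c v (not (c v)) ≤ᵇ N# G c v (c v) then c v else not (c v)

IsPure2Cycle : ∀ {n} → Process → Graph n → Coloring n → Set
IsPure2Cycle M G c =
  (∀ v → ¬ (run M G c v ≡ c v)) × (∀ v → run M G (run M G c) v ≡ c v)

isPure2Cycle? : ∀ {n} (M : Process) (G : Graph n) (c : Coloring n) → Dec (IsPure2Cycle M G c)
isPure2Cycle? M G c =
  all? (λ v → ¬? (run M G c v ≟ᵇ c v)) ×-dec all? (λ v → run M G (run M G c) v ≟ᵇ c v)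

allColorings : (n : ℕ) → List (Coloring n)
allColorings zero    = (λ ()) ∷ []
allColorings (suc n) =
  map (λ c → ext false c) (allColorings n) ++ map (λ c → ext true c) (allColorings n)
  where
  ext : Bool → Coloring n → Coloring (suc n)
  ext b c Fin.zero    = b
  ext b c (Fin.suc i) = c i

#pure2Cycles : ∀ {n} → Process → Graph n → ℕ
#pure2Cycles {n} M G =
  length (filter (isPure2Cycle? M G) (allColorings n))

fib : ℕ → ℕ
fib 0             = 0
fib 1             = 1
fib (suc (suc i)) = fib (suc i) + fib i

-- In a pure 2-cycle every node changes colour, so at every node v the neighbours
-- arguing for v keeping its colour ("bad" neighbours) are fewer than the others.
--
-- In a forest, the colour of a neighbour i of a vertex v is therefore determined
-- by the colours of the neighbours of i, none of which is adjacent to v.  Taking v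
-- of maximal degree Δ, a pure 2-cycle is determined by its values on the n − Δ
-- non-neighbours of v.
--
-- For the Fibonacci bound one counts, for arbitrary thresholds t, the colourings of
-- a tree in which every node v has at most t v bad neighbours, and shows that there
-- are at most 2 F(1 + Σ t) of them by removing a leaf.  Colourings in which the
-- leaf is a good neighbour of its parent restrict to colourings of the smaller tree
-- with the same thresholds; in the others the leaf has a bad neighbour and is a bad
-- neighbour of its parent, which costs one unit of both thresholds.  This gives the
-- recurrence F(S + 2) = F(S + 1) + F(S).  Every node of a pure 2-cycle satisfies
-- the threshold ⌊(deg v − 1) / 2⌋, and since Σ deg = 2n − 2 these add up to at most
-- ⌊n / 2⌋ − 1.

module Submission where

open import Defs
open import Data.Bool using (Bool; true; false; not; T; _∧_; _∨_; if_then_else_)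
open import Data.Bool.Properties using (not-involutive) renaming (_≟_ to _≟ᵇ_)
open import Data.Nat using (ℕ; zero; suc; pred; _+_; _*_; _^_; _∸_; _/_; _≤_; _<_; _⊔_; _≤ᵇ_; _≤?_; z≤n; s≤s)
open import Data.Nat.Properties hiding (_≟_)
open import Data.Nat.DivMod using (m*n/n≡m; /-monoˡ-≤; m/n*n≤m)
open import Algebra.Properties.CommutativeSemigroup +-commutativeSemigroup using (interchange)
open import Algebra.Properties.Semiring.Sum +-*-semiring
  using (sum; sum-syntax; sum-cong-≗; sum-remove; ∑-distrib-+; sum-replicate-zero; *-distribʳ-sum)
import Data.Nat.ListAction as ℕ
import Data.Nat.ListAction.Properties as ℕ
open import Data.Fin using (Fin; zero; suc; punchIn; punchOut; _≟_)
import Data.Fin.Properties as Finₚ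
open Finₚ using (all?; any?; pigeonhole)
open import Data.List using (List; []; _∷_; _++_; length; filter; map; allFin; tabulate; foldr; lookup)
open import Data.List.Properties using (map-++; map-∘; map-cong; length-++; length-map)
open import Data.List.Membership.Propositional.Properties using (∈-lookup; ∈-∃++)
import Data.List.Membership.DecPropositional as DecMembership
open import Data.List.Relation.Unary.Unique.Propositional using (Unique)
import Data.List.Relation.Unary.Unique.Propositional.Properties as Uniqueₚ
import Data.List.Relation.Unary.All as All
import Data.List.Relation.Unary.All.Properties as All
open import Data.Vec.Functional using (updateAt) renaming (_∷_ to _◃_)
open import Data.Vec.Functional.Properties using (updateAt-updates; updateAt-minimal)
open import Data.Product using (Σ; _×_; _,_; proj₁)
open import Data.Sum using (inj₁; inj₂)
open import Data.Unit using (tt)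
open import Data.List.Relation.Unary.All using ([]; _∷_)
open import Data.List.Relation.Unary.AllPairs using ([]; _∷_)
open import Data.Empty using (⊥; ⊥-elim)
open import Function using (_∘_; _$_)
open import Relation.Nullary using (yes; no; does; ¬_; ¬?)
open import Relation.Nullary.Decidable using (isYes; toWitness; fromWitness; decidable-stable; _×-dec_)
open import Relation.Unary using (Decidable)
open import Relation.Binary.PropositionalEquality

private
  variable
    n : ℕ

𝟙 : Bool → ℕ
𝟙 true  = 1
𝟙 false = 0

𝟙≤1 : ∀ b → 𝟙 b ≤ 1
𝟙≤1 true  = ≤-refl
𝟙≤1 false = z≤n

𝟙-+-≤-𝟙-∨ : ∀ {a b} → (T a → T b → ⊥) → 𝟙 a + 𝟙 b ≤ 𝟙 (a ∨ b)
𝟙-+-≤-𝟙-∨ {false} _ = ≤-refl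
𝟙-+-≤-𝟙-∨ {true} {false} _ = ≤-refl
𝟙-+-≤-𝟙-∨ {true} {true} ¬both = ⊥-elim (¬both tt tt)

𝟙-not-+-𝟙 : ∀ b → 𝟙 (not b) + 𝟙 b ≡ 1
𝟙-not-+-𝟙 false = refl
𝟙-not-+-𝟙 true  = refl

T-injective : ∀ {a b} → (T a → T b) → (T b → T a) → a ≡ b
T-injective {false} {false} _ _ = refl
T-injective {false} {true}  _ b⇒a = ⊥-elim (b⇒a tt)
T-injective {true}  {false} a⇒b _ = ⊥-elim (a⇒b tt)
T-injective {true}  {true}  _ _ = refl

sum-mono-≤ : ∀ {f g : Fin n → ℕ} → (∀ i → f i ≤ g i) → sum f ≤ sum g
sum-mono-≤ {zero}  f≤g = z≤n
sum-mono-≤ {suc n} f≤g = +-mono-≤ (f≤g zero) (sum-mono-≤ (f≤g ∘ suc))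

≤-sum : ∀ (f : Fin n → ℕ) i → f i ≤ sum f
≤-sum {suc n} f i = ≤-trans (m≤m+n (f i) _) (≤-reflexive (sym (sum-remove f)))

T⇒𝟙≡1 : ∀ {b} → T b → 𝟙 b ≡ 1
T⇒𝟙≡1 {true} _ = refl

¬T⇒𝟙≡0 : ∀ {b} → ¬ T b → 𝟙 b ≡ 0
¬T⇒𝟙≡0 {false} _  = refl
¬T⇒𝟙≡0 {true}  ¬b = ⊥-elim (¬b tt)

sum-ones : ∀ n → ∑[ i < n ] 1 ≡ n
sum-ones zero    = refl
sum-ones (suc n) = cong suc (sum-ones n)

-- Counting colourings

∑col : ∀ n → (Coloring n → ℕ) → ℕ
∑col zero    f = f (λ ())
∑col (suc n) f = ∑col n (f ∘ (false ◃_)) + ∑col n (f ∘ (true ◃_))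

#colorings : ∀ n → (Coloring n → Bool) → ℕ
#colorings n p = ∑col n (𝟙 ∘ p)

∑col-cong : ∀ n {f g : Coloring n → ℕ} → (∀ c → f c ≡ g c) → ∑col n f ≡ ∑col n g
∑col-cong zero    f≡g = f≡g (λ ())
∑col-cong (suc n) f≡g = cong₂ _+_ (∑col-cong n (f≡g ∘ (false ◃_))) (∑col-cong n (f≡g ∘ (true ◃_)))

∑col-mono-≤ : ∀ n {f g : Coloring n → ℕ} → (∀ c → f c ≤ g c) → ∑col n f ≤ ∑col n g
∑col-mono-≤ zero    f≤g = f≤g (λ ())
∑col-mono-≤ (suc n) f≤g =
  +-mono-≤ (∑col-mono-≤ n (f≤g ∘ (false ◃_))) (∑col-mono-≤ n (f≤g ∘ (true ◃_)))

∑col-distrib-+ : ∀ n (f g : Coloring n → ℕ) → ∑col n (λ c → f c + g c) ≡ ∑col n f + ∑col n g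
∑col-distrib-+ zero    f g = refl
∑col-distrib-+ (suc n) f g =
  trans (cong₂ _+_ (∑col-distrib-+ n (f ∘ (false ◃_)) (g ∘ (false ◃_)))
                   (∑col-distrib-+ n (f ∘ (true ◃_)) (g ∘ (true ◃_))))
        (interchange (∑col n (f ∘ (false ◃_))) (∑col n (g ∘ (false ◃_)))
                     (∑col n (f ∘ (true ◃_))) (∑col n (g ∘ (true ◃_))))

∑col-ones : ∀ n → ∑col n (λ _ → 1) ≡ 2 ^ n
∑col-ones zero    = refl
∑col-ones (suc n) = cong₂ _+_ (∑col-ones n) (trans (∑col-ones n) (sym (+-identityʳ _)))

#colorings≤2^n : ∀ n p → #colorings n p ≤ 2 ^ n
#colorings≤2^n n p = ≤-trans (∑col-mono-≤ n (𝟙≤1 ∘ p)) (≤-reflexive (∑col-ones n))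

#colorings-none : ∀ n {p : Coloring n → Bool} → (∀ c → ¬ T (p c)) → #colorings n p ≡ 0
#colorings-none zero    {p} ¬p = ¬T⇒𝟙≡0 (¬p (λ ()))
#colorings-none (suc n) {p} ¬p =
  cong₂ _+_ (#colorings-none n (¬p ∘ (false ◃_))) (#colorings-none n (¬p ∘ (true ◃_)))

insert : Coloring n → Fin (suc n) → Bool → Coloring (suc n)
insert         c zero    b = b ◃ c
insert {suc n} c (suc w) b = c zero ◃ insert (c ∘ suc) w b

insert-lookup : ∀ (c : Coloring n) w b → insert c w b w ≡ b
insert-lookup         c zero    b = refl
insert-lookup {suc n} c (suc w) b = insert-lookup (c ∘ suc) w b

insert-punchIn : ∀ (c : Coloring n) w b i → insert c w b (punchIn w i) ≡ c i
insert-punchIn         c zero    b i       = refl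
insert-punchIn {suc n} c (suc w) b zero    = refl
insert-punchIn {suc n} c (suc w) b (suc i) = insert-punchIn (c ∘ suc) w b i

∑col-insert : ∀ n w (f : Coloring (suc n) → ℕ) →
  ∑col (suc n) f ≡ ∑col n (λ c → f (insert c w false)) + ∑col n (λ c → f (insert c w true))
∑col-insert n       zero    f = refl
∑col-insert (suc n) (suc w) f =
  trans (cong₂ _+_ (∑col-insert n w (f ∘ (false ◃_))) (∑col-insert n w (f ∘ (true ◃_))))
        (interchange (∑col n (λ c → f (false ◃ insert c w false))) (∑col n (λ c → f (false ◃ insert c w true)))
                     (∑col n (λ c → f (true ◃ insert c w false))) (∑col n (λ c → f (true ◃ insert c w true))))

∑col-insert-by : ∀ n w (g : Coloring n → Bool) (f : Coloring (suc n) → ℕ) →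
  ∑col (suc n) f ≡ ∑col n (λ c → f (insert c w (g c))) + ∑col n (λ c → f (insert c w (not (g c))))
∑col-insert-by n w g f = begin
  ∑col (suc n) f
    ≡⟨ ∑col-insert n w f ⟩
  ∑col n (λ c → f (insert c w false)) + ∑col n (λ c → f (insert c w true))
    ≡⟨ ∑col-distrib-+ n _ _ ⟨
  ∑col n (λ c → f (insert c w false) + f (insert c w true))
    ≡⟨ ∑col-cong n (λ c → swap c (g c)) ⟩
  ∑col n (λ c → f (insert c w (g c)) + f (insert c w (not (g c))))
    ≡⟨ ∑col-distrib-+ n _ _ ⟩
  ∑col n (λ c → f (insert c w (g c))) + ∑col n (λ c → f (insert c w (not (g c)))) ∎
  where
  open ≡-Reasoning
  swap : ∀ c b → f (insert c w false) + f (insert c w true) ≡ f (insert c w b) + f (insert c w (not b))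
  swap c false = refl
  swap c true  = +-comm (f (insert c w false)) _

AgreeOn : (Fin n → Bool) → Coloring n → Coloring n → Set
AgreeOn R c c' = ∀ i → T (R i) → c i ≡ c' i

DeterminedBy : (Fin n → Bool) → (Coloring n → Bool) → Set
DeterminedBy R p = ∀ {c c'} → T (p c) → T (p c') → AgreeOn R c c' → ∀ i → c i ≡ c' i

#colorings-determinedBy : ∀ n R p → DeterminedBy {n} R p → #colorings n p ≤ 2 ^ ∑[ i < n ] 𝟙 (R i)
#colorings-determinedBy zero    R p D = 𝟙≤1 (p (λ ()))
#colorings-determinedBy (suc n) R p D with R zero in R₀
... | true = begin
  #colorings n (p ∘ (false ◃_)) + #colorings n (p ∘ (true ◃_))
    ≤⟨ +-mono-≤ (#colorings-determinedBy n (R ∘ suc) _ (fixing false))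
                (#colorings-determinedBy n (R ∘ suc) _ (fixing true)) ⟩
  2 ^ k + 2 ^ k
    ≡⟨ cong (2 ^ k +_) (+-identityʳ (2 ^ k)) ⟨
  2 ^ suc k ∎
  where
  open ≤-Reasoning
  k : ℕ
  k = ∑[ i < n ] 𝟙 (R (suc i))
  fixing : ∀ b → DeterminedBy (R ∘ suc) (p ∘ (b ◃_))
  fixing b pc pc' ag i = D pc pc' (λ { zero _ → refl ; (suc j) r → ag j r }) (suc i)
... | false = begin
  #colorings n (p ∘ (false ◃_)) + #colorings n (p ∘ (true ◃_))
    ≡⟨ ∑col-distrib-+ n _ _ ⟨
  ∑col n (λ c → 𝟙 (p (false ◃ c)) + 𝟙 (p (true ◃ c)))
    ≤⟨ ∑col-mono-≤ n (λ c → 𝟙-+-≤-𝟙-∨ (distinct c)) ⟩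
  #colorings n either
    ≤⟨ #colorings-determinedBy n (R ∘ suc) either D′ ⟩
  2 ^ ∑[ i < n ] 𝟙 (R (suc i)) ∎
  where
  open ≤-Reasoning
  either : Coloring n → Bool
  either c = p (false ◃ c) ∨ p (true ◃ c)
  agree : ∀ {b b' c c'} → AgreeOn (R ∘ suc) c c' → AgreeOn R (b ◃ c) (b' ◃ c')
  agree ag zero    r = ⊥-elim (subst T R₀ r)
  agree ag (suc j) r = ag j r
  distinct : ∀ c → T (p (false ◃ c)) → T (p (true ◃ c)) → ⊥
  distinct c pf pt with () ← D pf pt (agree (λ _ _ → refl)) zero
  witness : ∀ c → T (either c) → Σ Bool λ b → T (p (b ◃ c))
  witness c q with p (false ◃ c) in pf
  ... | true  = false , subst T (sym pf) q
  ... | false = true , q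
  D′ : DeterminedBy (R ∘ suc) either
  D′ {c} {c'} qc qc' ag i with witness c qc | witness c' qc'
  ... | b , pc | b' , pc' = D pc pc' (agree ag) (suc i)

Extensional : (Coloring n → ℕ) → Set
Extensional {n} f = ∀ {c c' : Coloring n} → (∀ i → c i ≡ c' i) → f c ≡ f c'

-- allColorings extends colourings by a local function that is only pointwise
-- equal to _◃_, whence the extensionality hypothesis.
sum-map-allColorings : ∀ n (f : Coloring n → ℕ) → Extensional f →
  ℕ.sum (map f (allColorings n)) ≡ ∑col n f
sum-map-allColorings zero    f f-ext = trans (+-identityʳ _) (f-ext (λ ()))
sum-map-allColorings (suc n) f f-ext =
  trans (cong ℕ.sum (map-++ f (map _ (allColorings n)) (map _ (allColorings n))))
        (trans (ℕ.sum-++ (map f (map _ (allColorings n))) _)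
               (cong₂ _+_ (half false _ (λ c → λ { zero → refl ; (suc i) → refl }))
                          (half true  _ (λ c → λ { zero → refl ; (suc i) → refl }))))
  where
  half : ∀ b (e : Coloring n → Coloring (suc n)) → (∀ c i → e c i ≡ (b ◃ c) i) →
         ℕ.sum (map f (map e (allColorings n))) ≡ ∑col n (f ∘ (b ◃_))
  half b e e≗ = begin
    ℕ.sum (map f (map e (allColorings n)))  ≡⟨ cong ℕ.sum (map-∘ (allColorings n)) ⟨
    ℕ.sum (map (f ∘ e) (allColorings n))    ≡⟨ cong ℕ.sum (map-cong (f-ext ∘ e≗) (allColorings n)) ⟩
    ℕ.sum (map (f ∘ (b ◃_)) (allColorings n)) ≡⟨ sum-map-allColorings n (f ∘ (b ◃_)) f◃-ext ⟩
    ∑col n (f ∘ (b ◃_)) ∎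
    where
    open ≡-Reasoning
    f◃-ext : Extensional (f ∘ (b ◃_))
    f◃-ext c≗c' = f-ext λ { zero → refl ; (suc i) → c≗c' i }

module _ {A : Set} {P : A → Set} (P? : Decidable P) where

  length-filter≤sum-𝟙 : ∀ (q : A → Bool) → (∀ x → P x → T (q x)) → ∀ xs →
    length (filter P? xs) ≤ ℕ.sum (map (𝟙 ∘ q) xs)
  length-filter≤sum-𝟙 q P⇒q [] = z≤n
  length-filter≤sum-𝟙 q P⇒q (x ∷ xs) with P? x
  ... | yes px = ≤-trans (s≤s (length-filter≤sum-𝟙 q P⇒q xs))
                         (≤-reflexive (cong (_+ _) (sym (T⇒𝟙≡1 (P⇒q x px)))))
  ... | no  _  = ≤-trans (length-filter≤sum-𝟙 q P⇒q xs) (m≤n+m _ _)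

  length-filter : ∀ xs → length (filter P? xs) ≡ ℕ.sum (map (𝟙 ∘ does ∘ P?) xs)
  length-filter [] = refl
  length-filter (x ∷ xs) with P? x
  ... | yes _ = cong suc (length-filter xs)
  ... | no  _ = length-filter xs

  sum-map-filter : ∀ (q : A → Bool) xs →
    ℕ.sum (map (𝟙 ∘ q) (filter P? xs)) ≡ ℕ.sum (map (λ x → 𝟙 (does (P? x) ∧ q x)) xs)
  sum-map-filter q [] = refl
  sum-map-filter q (x ∷ xs) with P? x
  ... | yes _ = cong (𝟙 (q x) +_) (sum-map-filter q xs)
  ... | no  _ = sum-map-filter q xs

sum-map-allFin : ∀ n (f : Fin n → ℕ) → ℕ.sum (map f (allFin n)) ≡ ∑[ i < n ] f i
sum-map-allFin n f = go n (λ i → i)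
  where
  go : ∀ m (g : Fin m → Fin n) → ℕ.sum (map f (tabulate g)) ≡ ∑[ i < m ] f (g i)
  go zero    g = refl
  go (suc m) g = cong (f (g zero) +_) (go m (g ∘ suc))

does-≟-true : ∀ b → does (b ≟ᵇ true) ≡ b
does-≟-true false = refl
does-≟-true true  = refl

deg : Graph n → Fin n → ℕ
deg {n} G v = ∑[ u < n ] 𝟙 (adj G v u)

nbrs : Graph n → Coloring n → Fin n → Bool → ℕ
nbrs {n} G c v i = ∑[ u < n ] 𝟙 (adj G v u ∧ does (c u ≟ᵇ i))

degree≡deg : ∀ (G : Graph n) v → degree G v ≡ deg G v
degree≡deg {n} G v = begin
  length (filter (λ u → adj G v u ≟ᵇ true) (allFin n))
    ≡⟨ length-filter _ (allFin n) ⟩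
  ℕ.sum (map (λ u → 𝟙 (does (adj G v u ≟ᵇ true))) (allFin n))
    ≡⟨ sum-map-allFin n _ ⟩
  ∑[ u < n ] 𝟙 (does (adj G v u ≟ᵇ true))
    ≡⟨ sum-cong-≗ (λ u → cong 𝟙 (does-≟-true (adj G v u))) ⟩
  deg G v ∎
  where open ≡-Reasoning

N#≡nbrs : ∀ (G : Graph n) c v i → N# G c v i ≡ nbrs G c v i
N#≡nbrs {n} G c v i = begin
  length (filter (λ u → c u ≟ᵇ i) (neighbours G v))
    ≡⟨ length-filter _ (neighbours G v) ⟩
  ℕ.sum (map (λ u → 𝟙 (does (c u ≟ᵇ i))) (neighbours G v))
    ≡⟨ sum-map-filter _ _ (allFin n) ⟩
  ℕ.sum (map (λ u → 𝟙 (does (adj G v u ≟ᵇ true) ∧ does (c u ≟ᵇ i))) (allFin n))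
    ≡⟨ sum-map-allFin n _ ⟩
  ∑[ u < n ] 𝟙 (does (adj G v u ≟ᵇ true) ∧ does (c u ≟ᵇ i))
    ≡⟨ sum-cong-≗ (λ u → cong (λ a → 𝟙 (a ∧ does (c u ≟ᵇ i))) (does-≟-true (adj G v u))) ⟩
  nbrs G c v i ∎
  where open ≡-Reasoning

nbrs-cong : ∀ (G : Graph n) {c c'} → (∀ i → c i ≡ c' i) → ∀ v b → nbrs G c v b ≡ nbrs G c' v b
nbrs-cong G c≗c' v b = sum-cong-≗ (λ u → cong (λ x → 𝟙 (adj G v u ∧ does (x ≟ᵇ b))) (c≗c' u))

-- Neighbours of colour badColour M (c v) argue for v keeping its colour; v changes
-- colour exactly when they are fewer than the others.
badColour : Process → Bool → Bool
badColour minority b = not b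
badColour majority b = b

Flips : Process → Graph n → Coloring n → Fin n → Set
Flips M G c v = nbrs G c v (badColour M (c v)) < nbrs G c v (not (badColour M (c v)))

flips? : ∀ M (G : Graph n) c → Decidable (Flips M G c)
flips? M G c v = nbrs G c v (badColour M (c v)) <? nbrs G c v (not (badColour M (c v)))

allFlip : Process → Graph n → Coloring n → Bool
allFlip M G c = isYes (all? (flips? M G c))

allFlip-sound : ∀ M (G : Graph n) {c} → T (allFlip M G c) → ∀ v → Flips M G c v
allFlip-sound M G {c} = toWitness {a? = all? (flips? M G c)}

allFlip-complete : ∀ M (G : Graph n) {c} → (∀ v → Flips M G c v) → T (allFlip M G c)
allFlip-complete M G {c} = fromWitness {a? = all? (flips? M G c)}

Flips-cong : ∀ M (G : Graph n) {c c'} → (∀ i → c i ≡ c' i) → ∀ v → Flips M G c v → Flips M G c' v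
Flips-cong M G {c} {c'} c≗c' v =
  subst (λ x → nbrs G c' v (badColour M x) < nbrs G c' v (not (badColour M x))) (c≗c' v)
  ∘ subst₂ _<_ (nbrs-cong G c≗c' v _) (nbrs-cong G c≗c' v _)

allFlip-extensional : ∀ M (G : Graph n) → Extensional (𝟙 ∘ allFlip M G)
allFlip-extensional M G c≗c' = cong 𝟙 (T-injective (transport c≗c') (transport (sym ∘ c≗c')))
  where
  transport : ∀ {c c'} → (∀ i → c i ≡ c' i) → T (allFlip M G c) → T (allFlip M G c')
  transport {c} {c'} c≗c' all = allFlip-complete M G {c'} (λ v → Flips-cong M G c≗c' v (allFlip-sound M G {c} all v))

unchanged-if : ∀ b x → ¬ (if b then x else not x) ≡ x → ¬ T b
unchanged-if true x changed _ = changed refl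

≤ᵇ-false⇒> : ∀ m n → ¬ T (m ≤ᵇ n) → n < m
≤ᵇ-false⇒> m n m≰ᵇn = ≰⇒> (m≰ᵇn ∘ ≤⇒≤ᵇ)

pure2Cycle⇒allFlip : ∀ M (G : Graph n) c → IsPure2Cycle M G c → T (allFlip M G c)
pure2Cycle⇒allFlip M G c (changes , _) = allFlip-complete M G {c} (λ v → flips M v (changes v))
  where
  flips : ∀ M v → ¬ run M G c v ≡ c v → Flips M G c v
  flips minority v changed =
    subst₂ _<_ (N#≡nbrs G c v _) (trans (N#≡nbrs G c v _) (cong (nbrs G c v) (sym (not-involutive (c v)))))
      (≤ᵇ-false⇒> _ _ (unchanged-if _ _ changed))
  flips majority v changed =
    subst₂ _<_ (N#≡nbrs G c v _) (N#≡nbrs G c v _) (≤ᵇ-false⇒> _ _ (unchanged-if _ _ changed))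

#pure2Cycles≤#allFlip : ∀ M (G : Graph n) → #pure2Cycles M G ≤ #colorings n (allFlip M G)
#pure2Cycles≤#allFlip {n} M G = begin
  length (filter (isPure2Cycle? M G) (allColorings n))
    ≤⟨ length-filter≤sum-𝟙 (isPure2Cycle? M G) (allFlip M G) (pure2Cycle⇒allFlip M G) (allColorings n) ⟩
  ℕ.sum (map (𝟙 ∘ allFlip M G) (allColorings n))
    ≡⟨ sum-map-allColorings n _ (allFlip-extensional M G) ⟩
  #colorings n (allFlip M G) ∎
  where open ≤-Reasoning

-- The bound 2 ^ (n ∸ Δ)

flipColour-unique : ∀ M (X : Bool → ℕ) {a a'} →
  X (badColour M a) < X (not (badColour M a)) → X (badColour M a') < X (not (badColour M a')) → a ≡ a'
flipColour-unique minority X {false} {false} _ _ = refl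
flipColour-unique minority X {false} {true}  p q = ⊥-elim (<-asym p q)
flipColour-unique minority X {true}  {false} p q = ⊥-elim (<-asym p q)
flipColour-unique minority X {true}  {true}  _ _ = refl
flipColour-unique majority X {false} {false} _ _ = refl
flipColour-unique majority X {false} {true}  p q = ⊥-elim (<-asym p q)
flipColour-unique majority X {true}  {false} p q = ⊥-elim (<-asym p q)
flipColour-unique majority X {true}  {true}  _ _ = refl

adj⇒≢ : ∀ (G : Graph n) {x y} → adj G x y ≡ true → ¬ x ≡ y
adj⇒≢ G {x} xy refl with () ← trans (sym xy) (irrefl G x)

acyclic⇒no-triangle : ∀ (G : Graph n) → Acyclic G → ∀ {u v w} →
  adj G u v ≡ true → adj G v w ≡ true → adj G w u ≡ true → ⊥
acyclic⇒no-triangle G ac {u} {v} {w} uv vw wu =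
  ac (_ , _ ∷ _ ∷ [] , distinct , s≤s (s≤s z≤n) , uv , vw , wu , tt)
  where
  distinct : Unique (u ∷ v ∷ w ∷ [])
  distinct = (adj⇒≢ G uv ∷ (adj⇒≢ G wu ∘ sym) ∷ []) ∷ (adj⇒≢ G vw ∷ []) ∷ [] ∷ []

-- In a forest the neighbours of a neighbour i of v are non-neighbours of v,
-- so they fix the counts that decide the colour of i in a coloring where i flips.
allFlip-determinedBy-nonNeighbours : ∀ M (G : Graph n) → Acyclic G → ∀ v →
  DeterminedBy (not ∘ adj G v) (allFlip M G)
allFlip-determinedBy-nonNeighbours M G ac v {c} {c'} fc fc' agree i with adj G v i in vi
... | false = agree i (subst (T ∘ not) (sym vi) tt)
... | true  = flipColour-unique M (nbrs G c i) (allFlip-sound M G {c} fc i)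
                (subst₂ _<_ (sym (same _)) (sym (same _)) (allFlip-sound M G {c'} fc' i))
  where
  nonNeighbour : ∀ z → adj G i z ≡ true → T (not (adj G v z))
  nonNeighbour z iz with adj G v z in vz
  ... | false = tt
  ... | true  = acyclic⇒no-triangle G ac vi iz (trans (symm G z v) vz)
  term : ∀ b z → adj G i z ∧ does (c z ≟ᵇ b) ≡ adj G i z ∧ does (c' z ≟ᵇ b)
  term b z with adj G i z in iz
  ... | false = refl
  ... | true  = cong (λ x → does (x ≟ᵇ b)) (agree z (nonNeighbour z iz))
  same : ∀ b → nbrs G c i b ≡ nbrs G c' i b
  same b = sum-cong-≗ (cong 𝟙 ∘ term b)

#nonNeighbours : ∀ (G : Graph n) v → ∑[ u < n ] 𝟙 (not (adj G v u)) ≡ n ∸ deg G v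
#nonNeighbours {n} G v = begin
  ∑[ u < n ] 𝟙 (not (adj G v u))
    ≡⟨ m+n∸n≡m _ (deg G v) ⟨
  ∑[ u < n ] 𝟙 (not (adj G v u)) + deg G v ∸ deg G v
    ≡⟨ cong (_∸ deg G v) (∑-distrib-+ (𝟙 ∘ not ∘ adj G v) (𝟙 ∘ adj G v)) ⟨
  ∑[ u < n ] (𝟙 (not (adj G v u)) + 𝟙 (adj G v u)) ∸ deg G v
    ≡⟨ cong (_∸ deg G v) (trans (sum-cong-≗ (λ u → 𝟙-not-+-𝟙 (adj G v u))) (sum-ones n)) ⟩
  n ∸ deg G v ∎
  where open ≡-Reasoning

foldr-⊔-attained : ∀ {A : Set} (f : A → ℕ) xs (a : A) → Σ A λ x → foldr _⊔_ 0 (map f xs) ≤ f x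
foldr-⊔-attained f []       a = a , z≤n
foldr-⊔-attained f (x ∷ xs) a with foldr-⊔-attained f xs a
... | y , xs≤fy with f x ≤? f y
...   | yes fx≤fy = y , ⊔-lub fx≤fy xs≤fy
...   | no  fx≰fy = x , ⊔-lub ≤-refl (≤-trans xs≤fy (<⇒≤ (≰⇒> fx≰fy)))

#pure2Cycles≤2^[n∸Δ] : ∀ M (G : Graph n) → Acyclic G → #pure2Cycles M G ≤ 2 ^ (n ∸ maxDegree G)
#pure2Cycles≤2^[n∸Δ] {zero}  M G _  = ≤-trans (#pure2Cycles≤#allFlip M G) (#colorings≤2^n 0 (allFlip M G))
#pure2Cycles≤2^[n∸Δ] {suc n} M G ac with foldr-⊔-attained (degree G) (allFin (suc n)) zero
... | v , Δ≤deg = begin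
  #pure2Cycles M G
    ≤⟨ #pure2Cycles≤#allFlip M G ⟩
  #colorings (suc n) (allFlip M G)
    ≤⟨ #colorings-determinedBy (suc n) _ _ (allFlip-determinedBy-nonNeighbours M G ac v) ⟩
  2 ^ ∑[ u < suc n ] 𝟙 (not (adj G v u))
    ≡⟨ cong (2 ^_) (#nonNeighbours G v) ⟩
  2 ^ (suc n ∸ deg G v)
    ≤⟨ ^-monoʳ-≤ 2 (∸-monoʳ-≤ (suc n) (≤-trans Δ≤deg (≤-reflexive (degree≡deg G v)))) ⟩
  2 ^ (suc n ∸ maxDegree G) ∎
  where open ≤-Reasoning

-- Leaves of trees

lookup-injective : ∀ {A : Set} {xs : List A} → Unique xs → ∀ i j → lookup xs i ≡ lookup xs j → i ≡ j
lookup-injective (x∉ ∷ u) zero    zero    eq = refl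
lookup-injective (x∉ ∷ u) zero    (suc j) eq = ⊥-elim (All.lookup x∉ (∈-lookup j) eq)
lookup-injective (x∉ ∷ u) (suc i) zero    eq = ⊥-elim (All.lookup x∉ (∈-lookup i) (sym eq))
lookup-injective (x∉ ∷ u) (suc i) (suc j) eq = cong suc (lookup-injective u i j eq)

unique⇒length≤ : ∀ {xs : List (Fin n)} → Unique xs → length xs ≤ n
unique⇒length≤ {n} {xs} u with length xs ≤? n
... | yes ≤n = ≤n
... | no  ≰n with i , j , i<j , eq ← pigeonhole (≰⇒> ≰n) (lookup xs) =
  ⊥-elim (Finₚ.<-irrefl (lookup-injective u i j eq) i<j)

unique-prefix : ∀ {A : Set} (xs : List A) z ys → Unique (xs ++ z ∷ ys) → Unique (xs ++ z ∷ [])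
unique-prefix []       z ys (_ ∷ _)  = [] ∷ []
unique-prefix (x ∷ xs) z ys (x∉ ∷ u) =
  All.++⁺ (All.++⁻ˡ xs x∉) (All.head (All.++⁻ʳ xs x∉) ∷ []) ∷ unique-prefix xs z ys u

chain-close : ∀ (G : Graph n) x a xs z ys → Chain G (a ∷ xs ++ z ∷ ys) → adj G z x ≡ true →
  Chain G (a ∷ (xs ++ z ∷ []) ++ x ∷ [])
chain-close G x a []       z ys (az , _)  zx = az , zx , tt
chain-close G x a (b ∷ xs) z ys (ab , ch) zx = ab , chain-close G x b xs z ys ch zx

record Leaf (G : Graph n) : Set where
  field
    leaf parent : Fin n
    leaf-parent : adj G leaf parent ≡ true
    only-parent : ∀ z → adj G leaf z ≡ true → z ≡ parent

module _ (G : Graph n) (ac : Acyclic G) where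

  open DecMembership (_≟_ {n}) using (_∈?_)

  -- Extend the path from its end x as long as possible; by acyclicity it
  -- never returns to itself, and it has at most n vertices.
  leaf-at-end : ∀ fuel x y rest → n < length (x ∷ y ∷ rest) + fuel →
    Unique (x ∷ y ∷ rest) → Chain G (x ∷ y ∷ rest) → Leaf G
  leaf-at-end zero x y rest long u ch =
    ⊥-elim (<⇒≱ (subst (n <_) (+-identityʳ _) long) (unique⇒length≤ u))
  leaf-at-end (suc fuel) x y rest long u ch
    with any? (λ z → (adj G x z ≟ᵇ true) ×-dec ¬? (z ≟ y))
  ... | no ¬other = record
    { leaf = x ; parent = y ; leaf-parent = proj₁ ch
    ; only-parent = λ z xz → decidable-stable (z ≟ y) (λ z≢y → ¬other (z , xz , z≢y)) }
  ... | yes (z , xz , z≢y) with z ∈? rest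
  ...   | yes z∈rest with pre , post , refl ← ∈-∃++ {v = z} {xs = rest} z∈rest =
    ⊥-elim $ ac (x , y ∷ pre ++ z ∷ [] , unique-prefix (x ∷ y ∷ pre) z post u , s≤s nonempty ,
        chain-close G x x (y ∷ pre) z post ch (trans (symm G z x) xz))
    where
    nonempty : 1 ≤ length (pre ++ z ∷ [])
    nonempty = subst (1 ≤_) (sym (length-++ pre)) (m≤n+m 1 (length pre))
  ...   | no z∉rest =
    leaf-at-end fuel z x (y ∷ rest) (subst (n <_) (+-suc _ fuel) long)
      (((adj⇒≢ G xz ∘ sym) ∷ z≢y ∷ All.¬Any⇒All¬ rest z∉rest) ∷ u) (trans (symm G z x) xz , ch)

tree⇒leaf : ∀ (G : Graph (suc (suc n))) → IsTree G → Leaf G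
tree⇒leaf {n} G (_ , connected , ac) with connected zero (suc zero)
... | step {w = u} 0u _ =
  leaf-at-end G ac (suc (suc n)) u zero [] (s≤s (n≤1+n _))
    (((adj⇒≢ G 0u ∘ sym) ∷ []) ∷ [] ∷ []) (trans (symm G u zero) 0u , tt)

nontrivial-walk⇒deg≥1 : ∀ (G : Graph n) {x y} → Walk G x y → ¬ x ≡ y → 1 ≤ deg G x
nontrivial-walk⇒deg≥1 G here                    x≢y = ⊥-elim (x≢y refl)
nontrivial-walk⇒deg≥1 G {x} (step {w = z} xz _) _  =
  ≤-trans (≤-reflexive (cong 𝟙 (sym xz))) (≤-sum (𝟙 ∘ adj G x) z)

sum-𝟙-unique : ∀ (f : Fin (suc n) → Bool) i → f i ≡ true → (∀ j → f j ≡ true → j ≡ i) →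
  ∑[ j < suc n ] 𝟙 (f j) ≡ 1
sum-𝟙-unique {n} f i fi only-i = begin
  ∑[ j < suc n ] 𝟙 (f j)                   ≡⟨ sum-remove (𝟙 ∘ f) ⟩
  𝟙 (f i) + ∑[ k < n ] 𝟙 (f (punchIn i k)) ≡⟨ cong₂ _+_ (cong 𝟙 fi) (sum-cong-≗ others) ⟩
  1 + ∑[ k < n ] 0                         ≡⟨ cong suc (sum-replicate-zero n) ⟩
  1 ∎
  where
  open ≡-Reasoning
  others : ∀ k → 𝟙 (f (punchIn i k)) ≡ 0
  others k with f (punchIn i k) in fk
  ... | false = refl
  ... | true  = ⊥-elim (Finₚ.punchInᵢ≢i i k (only-i _ fk))

module Pruning {n : ℕ} (G : Graph (suc (suc n))) (L : Leaf G) where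
  open Leaf L

  pI : Fin (suc n) → Fin (suc (suc n))
  pI = punchIn leaf

  prune : Graph (suc n)
  prune = record
    { adj    = λ u v → adj G (pI u) (pI v)
    ; symm   = λ u v → symm G (pI u) (pI v)
    ; irrefl = λ v → irrefl G (pI v)
    }

  parent⁻ : Fin (suc n)
  parent⁻ = punchOut (adj⇒≢ G leaf-parent)

  pI-parent⁻ : pI parent⁻ ≡ parent
  pI-parent⁻ = Finₚ.punchIn-punchOut (adj⇒≢ G leaf-parent)

  parent-leaf : adj G parent leaf ≡ true
  parent-leaf = trans (symm G parent leaf) leaf-parent

  parent⁻-leaf : adj G (pI parent⁻) leaf ≡ true
  parent⁻-leaf = trans (cong (λ x → adj G x leaf) pI-parent⁻) parent-leaf

  only-parent⁻ : ∀ v → adj G (pI v) leaf ≡ true → v ≡ parent⁻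
  only-parent⁻ v vl = Finₚ.punchIn-injective leaf v parent⁻
    (trans (only-parent (pI v) (trans (symm G leaf (pI v)) vl)) (sym pI-parent⁻))

  -- A walk entering the leaf comes from the parent and must return to it.
  walk-prune : ∀ {a b} a⁻ b⁻ → a ≡ pI a⁻ → b ≡ pI b⁻ → Walk G a b → Walk prune a⁻ b⁻
  walk-prune a⁻ b⁻ a≡ b≡ here =
    subst (Walk prune a⁻) (Finₚ.punchIn-injective leaf a⁻ b⁻ (trans (sym a≡) b≡)) here
  walk-prune {a} a⁻ b⁻ a≡ b≡ (step {w = m} am wk) with m ≟ leaf
  ... | no m≢leaf = step am⁻ (walk-prune (punchOut (m≢leaf ∘ sym)) b⁻ (sym m≡) b≡ wk)
    where
    m≡ : pI (punchOut (m≢leaf ∘ sym)) ≡ m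
    m≡ = Finₚ.punchIn-punchOut (m≢leaf ∘ sym)
    am⁻ : adj G (pI a⁻) (pI (punchOut (m≢leaf ∘ sym))) ≡ true
    am⁻ = subst₂ (λ x y → adj G x y ≡ true) a≡ (sym m≡) am
  walk-prune a⁻ b⁻ a≡ b≡ (step am here)                 | yes refl =
    ⊥-elim (Finₚ.punchInᵢ≢i leaf b⁻ (sym b≡))
  walk-prune {a} a⁻ b⁻ a≡ b≡ (step am (step {w = m} lm wk)) | yes refl =
    walk-prune a⁻ b⁻ (trans (only-parent m lm) (trans (sym (only-parent a (trans (symm G leaf a) am))) a≡)) b≡ wk

  chain-pI : ∀ ys → Chain prune ys → Chain G (map pI ys)
  chain-pI []           _        = tt
  chain-pI (x ∷ [])     _        = tt
  chain-pI (x ∷ y ∷ ys) (xy , ch) = xy , chain-pI (y ∷ ys) ch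

  prune-isTree : IsTree G → IsTree prune
  prune-isTree (_ , connected , ac) =
    s≤s z≤n , (λ u v → walk-prune u v refl refl (connected (pI u) (pI v))) , ac⁻
    where
    ac⁻ : Acyclic prune
    ac⁻ (x , xs , u , long , ch) =
      ac (pI x , map pI xs , Uniqueₚ.map⁺ (Finₚ.punchIn-injective leaf _ _) u ,
          subst (2 ≤_) (sym (length-map pI xs)) long ,
          subst (λ l → Chain G (pI x ∷ l)) (map-++ pI xs (x ∷ [])) (chain-pI (x ∷ xs ++ x ∷ []) ch))

  nbrs-insert : ∀ c b v i →
    nbrs G (insert c leaf b) (pI v) i ≡ 𝟙 (adj G (pI v) leaf ∧ does (b ≟ᵇ i)) + nbrs prune c v i
  nbrs-insert c b v i =
    trans (sum-remove {i = leaf} (λ u → 𝟙 (adj G (pI v) u ∧ does (insert c leaf b u ≟ᵇ i)))) (cong₂ _+_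
    (cong (λ x → 𝟙 (adj G (pI v) leaf ∧ does (x ≟ᵇ i))) (insert-lookup c leaf b))
    (sum-cong-≗ (λ u → cong (λ x → 𝟙 (adj G (pI v) (pI u) ∧ does (x ≟ᵇ i))) (insert-punchIn c leaf b u))))

  ∑deg-prune : ∑[ v < suc (suc n) ] deg G v ≡ 2 + ∑[ v < suc n ] deg prune v
  ∑deg-prune = begin
    ∑[ v < suc (suc n) ] deg G v
      ≡⟨ sum-remove (deg G) ⟩
    deg G leaf + ∑[ v < suc n ] deg G (pI v)
      ≡⟨ cong₂ _+_ (sum-𝟙-unique _ parent leaf-parent only-parent)
                   (sum-cong-≗ (λ v → sum-remove {i = leaf} (𝟙 ∘ adj G (pI v)))) ⟩
    1 + ∑[ v < suc n ] (𝟙 (adj G (pI v) leaf) + deg prune v)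
      ≡⟨ cong (1 +_) (∑-distrib-+ (λ v → 𝟙 (adj G (pI v) leaf)) (deg prune)) ⟩
    1 + (∑[ v < suc n ] 𝟙 (adj G (pI v) leaf) + ∑[ v < suc n ] deg prune v)
      ≡⟨ cong (λ k → 1 + (k + ∑[ v < suc n ] deg prune v))
           (sum-𝟙-unique _ parent⁻ parent⁻-leaf only-parent⁻) ⟩
    2 + ∑[ v < suc n ] deg prune v ∎
    where open ≡-Reasoning

∑deg-tree : ∀ n (G : Graph (suc n)) → IsTree G → ∑[ v < suc n ] deg G v + 2 ≡ 2 * suc n
∑deg-tree zero    G _    = cong (λ b → 𝟙 b + 0 + 0 + 2) (irrefl G zero)
∑deg-tree (suc n) G tree = begin
  ∑[ v < suc (suc n) ] deg G v + 2  ≡⟨ cong (_+ 2) ∑deg-prune ⟩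
  2 + (∑[ v < suc n ] deg prune v + 2) ≡⟨ cong (2 +_) (∑deg-tree n prune (prune-isTree tree)) ⟩
  2 + 2 * suc n                     ≡⟨ *-suc 2 (suc n) ⟨
  2 * suc (suc n) ∎
  where
  open ≡-Reasoning
  open Pruning G (tree⇒leaf G tree)

tree⇒deg≥1 : ∀ (G : Graph (suc (suc n))) → IsTree G → ∀ v → 1 ≤ deg G v
tree⇒deg≥1 G (_ , connected , _) zero    = nontrivial-walk⇒deg≥1 G (connected zero (suc zero)) λ ()
tree⇒deg≥1 G (_ , connected , _) (suc i) = nontrivial-walk⇒deg≥1 G (connected (suc i) zero) λ ()

-- The Fibonacci bound

fib≤fib-suc : ∀ k → fib k ≤ fib (suc k)
fib≤fib-suc zero    = z≤n
fib≤fib-suc (suc k) = m≤m+n (fib (suc k)) (fib k)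

fib-mono : ∀ {j k} → j ≤ k → fib j ≤ fib k
fib-mono {k = zero}  z≤n = ≤-refl
fib-mono {k = suc k} j≤1+k with m≤n⇒m<n∨m≡n j≤1+k
... | inj₁ (s≤s j≤k) = ≤-trans (fib-mono j≤k) (fib≤fib-suc k)
... | inj₂ refl      = ≤-refl

-- g and b count colourings with the leaf good resp. bad for its parent, k is the leaf's threshold.
fib-step-bound : ∀ {g b S} k → g ≤ 2 * fib (suc S) → (k ≡ 0 → b ≡ 0) → b ≤ 2 * fib S →
  g + b ≤ 2 * fib (suc (k + S))
fib-step-bound {g} zero    g≤ b≡0 _ = ≤-trans (≤-reflexive (trans (cong (g +_) (b≡0 refl)) (+-identityʳ g))) g≤
fib-step-bound {g} {b} {S} (suc k) g≤ _ b≤ = begin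
  g + b                             ≤⟨ +-mono-≤ g≤ b≤ ⟩
  2 * fib (suc S) + 2 * fib S       ≡⟨ *-distribˡ-+ 2 (fib (suc S)) (fib S) ⟨
  2 * fib (suc (suc S))             ≤⟨ *-monoʳ-≤ 2 (fib-mono (s≤s (s≤s (m≤n+m S k)))) ⟩
  2 * fib (suc (suc k + S)) ∎
  where open ≤-Reasoning

sum-updateAt-pred : ∀ (xs : Fin n → ℕ) i {k} → xs i ≡ suc k → suc (sum (updateAt xs i pred)) ≡ sum xs
sum-updateAt-pred {suc n} xs i {k} xsi = begin
  suc (sum (updateAt xs i pred))
    ≡⟨ cong suc (sum-remove (updateAt xs i pred)) ⟩
  suc (updateAt xs i pred i + ∑[ j < n ] updateAt xs i pred (punchIn i j))
    ≡⟨ cong₂ (λ x y → suc (x + y)) (trans (updateAt-updates i xs) (cong pred xsi))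
             (sum-cong-≗ (λ j → updateAt-minimal (punchIn i j) i xs (Finₚ.punchInᵢ≢i i j))) ⟩
  suc (k + ∑[ j < n ] xs (punchIn i j))
    ≡⟨ cong (_+ ∑[ j < n ] xs (punchIn i j)) xsi ⟨
  xs i + ∑[ j < n ] xs (punchIn i j)
    ≡⟨ sum-remove xs ⟨
  sum xs ∎
  where open ≡-Reasoning

badColour-involutive : ∀ M b → badColour M (badColour M b) ≡ b
badColour-involutive minority b = not-involutive b
badColour-involutive majority b = refl

does-≟-refl : ∀ b → does (b ≟ᵇ b) ≡ true
does-≟-refl false = refl
does-≟-refl true  = refl

BadBounded : Process → Graph n → (Fin n → ℕ) → Coloring n → Set
BadBounded M G t c = ∀ v → nbrs G c v (badColour M (c v)) ≤ t v

-- The leaf is a bad neighbour of its parent exactly when the parent is a bad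
-- neighbour of the leaf; colourings of G are split according to this.
module LeafStep (M : Process) {m : ℕ} (G : Graph (suc (suc m))) (L : Leaf G)
                (t : Fin (suc (suc m)) → ℕ) (p : Coloring (suc (suc m)) → Bool)
                (bounded : ∀ c → T (p c) → BadBounded M G t c) where
  open Leaf L
  open Pruning G L public

  t⁻ : Fin (suc m) → ℕ
  t⁻ = t ∘ pI

  badLeaf : Coloring (suc m) → Bool
  badLeaf c = badColour M (c parent⁻)

  goodExt badExt : Coloring (suc m) → Coloring (suc (suc m))
  goodExt c = insert c leaf (not (badLeaf c))
  badExt  c = insert c leaf (badLeaf c)

  #split : #colorings (suc (suc m)) p ≡ #colorings (suc m) (p ∘ goodExt) + #colorings (suc m) (p ∘ badExt)
  #split = trans (∑col-insert-by (suc m) leaf (not ∘ badLeaf) (𝟙 ∘ p))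
                 (cong (#colorings (suc m) (p ∘ goodExt) +_) (∑col-cong (suc m) not-not))
    where
    not-not : ∀ c → 𝟙 (p (insert c leaf (not (not (badLeaf c))))) ≡ 𝟙 (p (badExt c))
    not-not c = cong (λ b → 𝟙 (p (insert c leaf b))) (not-involutive (badLeaf c))

  restrict : ∀ c b → T (p (insert c leaf b)) → BadBounded M prune t⁻ c
  restrict c b pc v =
    ≤-trans (≤-trans (m≤n+m _ (𝟙 (adj G (pI v) leaf ∧ does (b ≟ᵇ badColour M (c v)))))
                     (≤-reflexive (sym (nbrs-insert c b v _))))
            (subst (λ x → nbrs G (insert c leaf b) (pI v) (badColour M x) ≤ t⁻ v) (insert-punchIn c leaf b v)
                   (bounded _ pc (pI v)))

  parent-colour : ∀ c b → insert c leaf b parent ≡ c parent⁻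
  parent-colour c b = trans (cong (insert c leaf b) (sym pI-parent⁻)) (insert-punchIn c leaf b parent⁻)

  bad⇒t[leaf]≥1 : ∀ c → T (p (badExt c)) → 1 ≤ t leaf
  bad⇒t[leaf]≥1 c pc = begin
    1
      ≡⟨ cong₂ (λ a x → 𝟙 (a ∧ x)) leaf-parent parent-is-bad ⟨
    𝟙 (adj G leaf parent ∧ does (badExt c parent ≟ᵇ badColour M (badExt c leaf)))
      ≤⟨ ≤-sum (λ u → 𝟙 (adj G leaf u ∧ does (badExt c u ≟ᵇ badColour M (badExt c leaf)))) parent ⟩
    nbrs G (badExt c) leaf (badColour M (badExt c leaf))
      ≤⟨ bounded (badExt c) pc leaf ⟩
    t leaf ∎
    where
    open ≤-Reasoning
    parent-is-bad : does (badExt c parent ≟ᵇ badColour M (badExt c leaf)) ≡ true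
    parent-is-bad = trans (cong₂ (λ x y → does (x ≟ᵇ badColour M y)) (parent-colour c _) (insert-lookup c leaf _))
                          (trans (cong (λ y → does (c parent⁻ ≟ᵇ y)) (badColour-involutive M _)) (does-≟-refl (c parent⁻)))

  bad⇒parent-bound : ∀ c → T (p (badExt c)) →
    1 + nbrs prune c parent⁻ (badLeaf c) ≤ t⁻ parent⁻
  bad⇒parent-bound c pc = begin
    1 + nbrs prune c parent⁻ (badLeaf c)
      ≡⟨ cong (λ a → 𝟙 a + nbrs prune c parent⁻ (badLeaf c)) leaf-is-bad ⟨
    𝟙 (adj G (pI parent⁻) leaf ∧ does (badLeaf c ≟ᵇ badLeaf c)) + nbrs prune c parent⁻ (badLeaf c)
      ≡⟨ nbrs-insert c _ parent⁻ _ ⟨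
    nbrs G (badExt c) (pI parent⁻) (badLeaf c)
      ≡⟨ cong (λ x → nbrs G (badExt c) (pI parent⁻) (badColour M x)) (insert-punchIn c leaf _ parent⁻) ⟨
    nbrs G (badExt c) (pI parent⁻) (badColour M (badExt c (pI parent⁻)))
      ≤⟨ bounded (badExt c) pc (pI parent⁻) ⟩
    t⁻ parent⁻ ∎
    where
    open ≤-Reasoning
    leaf-is-bad : adj G (pI parent⁻) leaf ∧ does (badLeaf c ≟ᵇ badLeaf c) ≡ true
    leaf-is-bad = cong₂ _∧_ parent⁻-leaf (does-≟-refl (badLeaf c))

  bad-bounded : ∀ c → T (p (badExt c)) → BadBounded M prune (updateAt t⁻ parent⁻ pred) c
  bad-bounded c pc v with v ≟ parent⁻
  ... | yes refl = subst (_ ≤_) (sym (updateAt-updates parent⁻ t⁻)) (pred-mono-≤ (bad⇒parent-bound c pc))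
  ... | no  v≢p  = subst (_ ≤_) (sym (updateAt-minimal v parent⁻ t⁻ v≢p)) (restrict c _ pc v)

#colorings-badBounded : ∀ M m (G : Graph (suc m)) → IsTree G → ∀ t p →
  (∀ c → T (p c) → BadBounded M G t c) → #colorings (suc m) p ≤ 2 * fib (suc (sum t))
#colorings-badBounded M zero G _ t p _ =
  ≤-trans (#colorings≤2^n 1 p) (*-monoʳ-≤ 2 (fib-mono {1} {suc (sum t)} (s≤s z≤n)))
#colorings-badBounded M (suc m) G tree t p bounded = begin
  #colorings (suc (suc m)) p
    ≡⟨ #split ⟩
  #colorings (suc m) (λ c → p (goodExt c)) + #bad
    ≤⟨ fib-step-bound (t leaf) good≤ no-bad bad≤ ⟩
  2 * fib (suc (t leaf + sum t⁻))
    ≡⟨ cong (λ s → 2 * fib (suc s)) (sum-remove {i = leaf} t) ⟨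
  2 * fib (suc (sum t)) ∎
  where
  L : Leaf G
  L = tree⇒leaf G tree
  open Leaf L
  open LeafStep M G L t p bounded
  open ≤-Reasoning
  IH : ∀ t′ p′ → (∀ c → T (p′ c) → BadBounded M prune t′ c) → #colorings (suc m) p′ ≤ 2 * fib (suc (sum t′))
  IH = #colorings-badBounded M m prune (prune-isTree tree)
  #bad : ℕ
  #bad = #colorings (suc m) (λ c → p (badExt c))
  good≤ : #colorings (suc m) (λ c → p (goodExt c)) ≤ 2 * fib (suc (sum t⁻))
  good≤ = IH t⁻ _ (λ c → restrict c (not (badLeaf c)))
  no-bad : t leaf ≡ 0 → #bad ≡ 0
  no-bad tl = #colorings-none (suc m) (λ c pc → 1+n≰n (subst (1 ≤_) tl (bad⇒t[leaf]≥1 c pc)))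
  bad≤ : #bad ≤ 2 * fib (sum t⁻)
  bad≤ with t⁻ parent⁻ in tp
  ... | zero  = ≤-trans (≤-reflexive (#colorings-none (suc m) λ c pc →
                  1+n≰n (≤-trans (m≤m+n 1 _)
                    (subst (1 + nbrs prune c parent⁻ (badLeaf c) ≤_) tp (bad⇒parent-bound c pc))))) z≤n
  ... | suc _ = ≤-trans (IH (updateAt t⁻ parent⁻ pred) _ bad-bounded)
                  (≤-reflexive (cong (λ s → 2 * fib s) (sum-updateAt-pred t⁻ parent⁻ tp)))

nbrs-+-not : ∀ (G : Graph n) c v b → nbrs G c v b + nbrs G c v (not b) ≡ deg G v
nbrs-+-not G c v b =
  trans (sym (∑-distrib-+ (λ u → 𝟙 (adj G v u ∧ does (c u ≟ᵇ b))) _)) (sum-cong-≗ λ u → split (adj G v u) (c u) b)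
  where
  split : ∀ a x b → 𝟙 (a ∧ does (x ≟ᵇ b)) + 𝟙 (a ∧ does (x ≟ᵇ not b)) ≡ 𝟙 a
  split false _     _     = refl
  split true  false false = refl
  split true  false true  = refl
  split true  true  false = refl
  split true  true  true  = refl

*2≤⇒≤/2 : ∀ {x k} → x * 2 ≤ k → x ≤ k / 2
*2≤⇒≤/2 {x} x*2≤k = ≤-trans (≤-reflexive (sym (m*n/n≡m x 2))) (/-monoˡ-≤ 2 x*2≤k)

halfDeg : Graph n → Fin n → ℕ
halfDeg G v = (deg G v ∸ 1) / 2

flips⇒badBounded : ∀ M (G : Graph n) c → (∀ v → Flips M G c v) → BadBounded M G (halfDeg G) c
flips⇒badBounded M G c flips v = *2≤⇒≤/2 (m+n≤o⇒m≤o∸n _ (begin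
  bad * 2 + 1 ≡⟨ cong (_+ 1) (*-comm bad 2) ⟩
  bad + (bad + 0) + 1 ≡⟨ trans (+-comm _ 1) (cong suc (cong (bad +_) (+-identityʳ bad))) ⟩
  suc (bad + bad) ≡⟨ +-suc bad bad ⟨
  bad + suc bad ≤⟨ +-monoʳ-≤ bad (flips v) ⟩
  bad + nbrs G c v (not (badColour M (c v))) ≡⟨ nbrs-+-not G c v _ ⟩
  deg G v ∎))
  where
  open ≤-Reasoning
  bad : ℕ
  bad = nbrs G c v (badColour M (c v))

suc-∑halfDeg≤n/2 : ∀ m (G : Graph (suc (suc m))) → IsTree G → suc (sum (halfDeg G)) ≤ suc (suc m) / 2
suc-∑halfDeg≤n/2 m G tree = *2≤⇒≤/2 (begin
  2 + sum (halfDeg G) * 2           ≤⟨ +-monoʳ-≤ 2 (≤-trans (≤-reflexive (*-distribʳ-sum 2 (halfDeg G)))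
                                        (sum-mono-≤ λ v → m/n*n≤m (deg G v ∸ 1) 2)) ⟩
  2 + ∑[ v < N ] (deg G v ∸ 1)      ≡⟨ +-cancelʳ-≡ N _ _ (begin-equality
      2 + ∑[ v < N ] (deg G v ∸ 1) + N   ≡⟨ +-assoc 2 _ N ⟩
      2 + (∑[ v < N ] (deg G v ∸ 1) + N) ≡⟨ cong (2 +_) ∑deg∸1+N ⟩
      2 + ∑[ v < N ] deg G v             ≡⟨ +-comm 2 _ ⟩
      ∑[ v < N ] deg G v + 2             ≡⟨ ∑deg-tree (suc m) G tree ⟩
      2 * N                              ≡⟨ cong (N +_) (+-identityʳ N) ⟩
      N + N ∎) ⟩
  N ∎)
  where
  open ≤-Reasoning
  N : ℕ
  N = suc (suc m)
  ∑deg∸1+N : ∑[ v < N ] (deg G v ∸ 1) + N ≡ ∑[ v < N ] deg G v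
  ∑deg∸1+N = begin-equality
    ∑[ v < N ] (deg G v ∸ 1) + N         ≡⟨ cong (∑[ v < N ] (deg G v ∸ 1) +_) (sum-ones N) ⟨
    ∑[ v < N ] (deg G v ∸ 1) + ∑[ v < N ] 1 ≡⟨ ∑-distrib-+ (λ v → deg G v ∸ 1) (λ _ → 1) ⟨
    ∑[ v < N ] (deg G v ∸ 1 + 1)         ≡⟨ sum-cong-≗ (λ v → m∸n+n≡m (tree⇒deg≥1 G tree v)) ⟩
    ∑[ v < N ] deg G v ∎

#pure2Cycles≤2*fib[n/2] : ∀ M (G : Graph n) → IsTree G → #pure2Cycles M G ≤ 2 * fib (n / 2)
#pure2Cycles≤2*fib[n/2] {zero}        M G (() , _)
#pure2Cycles≤2*fib[n/2] {suc zero}    M G _ =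
  ≤-trans (#pure2Cycles≤#allFlip M G) (≤-reflexive (#colorings-none 1 λ c f → <-irrefl
    (trans (isolated c _) (sym (isolated c _))) (allFlip-sound M G {c} f zero)))
  where
  isolated : ∀ c b → nbrs G c zero b ≡ 0
  isolated c b = cong (λ a → 𝟙 (a ∧ does (c zero ≟ᵇ b)) + 0) (irrefl G zero)
#pure2Cycles≤2*fib[n/2] {suc (suc m)} M G tree = begin
  #pure2Cycles M G                       ≤⟨ #pure2Cycles≤#allFlip M G ⟩
  #colorings (suc (suc m)) (allFlip M G) ≤⟨ #colorings-badBounded M (suc m) G tree (halfDeg G) (allFlip M G)
                                              (λ c f → flips⇒badBounded M G c (allFlip-sound M G {c} f)) ⟩
  2 * fib (suc (sum (halfDeg G)))        ≤⟨ *-monoʳ-≤ 2 (fib-mono (suc-∑halfDeg≤n/2 m G tree)) ⟩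
  2 * fib (suc (suc m) / 2) ∎
  where open ≤-Reasoning

theorem3 : (M : Process) (n : ℕ) (G : Graph n) → IsTree G →
    (#pure2Cycles M G ≤ 2 ^ (n ∸ maxDegree G)) × (#pure2Cycles M G ≤ 2 * fib (n / 2))
theorem3 M n G tree@(_ , _ , acyclic) =
  #pure2Cycles≤2^[n∸Δ] M G acyclic , #pure2Cycles≤2*fib[n/2] M G tree
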